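{- Let $G$ be a finite group, $T\le G$ a subgroup with normal complement $S$ in $G$. Let $A\le\mathrm{Perm}(G/T)$ be a regular subgroup normalized by left translations $\lambda(G)$, and $B\le\mathrm{Perm}(T)$ a regular subgroup normalized by $\lambda_T(T)$. For $a\in A$ and $s\in S$ write $a[s]$ for the unique $s'\in S$ with $a[sT]=s'T$, and let $N=\{\eta(a,b):a\in A,b\in B\}\le\mathrm{Perm}(G)$, where $\eta(a,b)[st]=a[s]\,b[t]$ for $s\in S$, $t\in T$. Let $g\in G$, $\varphi=\varphi_g$ (the inner automorphism $x\mapsto gxg^{ -1}$), $T'=\varphi(T)$ (so $S$ is also a normal complement of $T'$), $A'=\bar\varphi A\bar\varphi^{ -1}\le\mathrm{Perm}(G/T')$ with $\bar\varphi(xT)=\varphi(x)T'$, and $B'=\varphi|_T B(\varphi|_T)^{ -1}\le\mathrm{Perm}(T')$. For $a'\in A'$, $s\in S$ write $a'[s]$ for the unique $s'\in S$ with $a'[sT']=s'T'$, and define $\eta'(a',b')\in\mathrm{Perm}(G)$ by $\eta'(a',b')[st']=a'[s]\,b'[t']$ for $s\in S$, $t'\in T'$. Then $$\rho(g)N\rho(g)^{ -1}=\{\eta'(a',b'): a'\in A',\ b'\in B'\},$$ i.e. $\rho(g)N\rho(g)^{ -1}$ is the subgroup induced from $A'$ and $B'$.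
   Context: $\mathrm{Perm}(X)$ is the group of permutations of a set $X$. $\lambda(h)[xT]=hxT$ is left translation on cosets; $\lambda_T$ is the left regular representation of $T$; $\rho(g)[x]=xg^{ -1}$ is the right regular representation of $G$ on itself. A subgroup of $\mathrm{Perm}(X)$ is regular if it acts simply transitively on $X$. A normal complement $S$ of $T$ means $S\trianglelefteq G$, $G=ST$, $S\cap T=\{e\}$, so each element of $G$ is uniquely $st$ with $s\in S,t\in T$. ($A'$ and $B'$ are regular subgroups normalized by $\lambda(G)$ on $G/T'$ and by $\lambda_{T'}(T')$ respectively.) -}

module Defs where

open import Level using (0ℓ)
open import Algebra.Bundles using (Group)
open import Data.Product using (Σ; Σ-syntax; _×_; _,_; proj₁; proj₂)
open import Data.Nat using (ℕ)
open import Data.Fin using (Fin)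
open import Relation.Binary.Bundles using (Setoid)
import Relation.Binary.PropositionalEquality as ≡
open import Function.Bundles using (Inverse; Func)
import Function.Construct.Identity as Id
import Function.Construct.Composition as Comp
import Function.Construct.Symmetry as Sym
import Algebra.Properties.Group as GP
import Relation.Binary.Reasoning.Setoid as SR

module _ (X : Setoid 0ℓ 0ℓ) where
  open Setoid X

  Perm : Set
  Perm = Inverse X X

  _≗ₚ_ : Perm → Perm → Set
  f ≗ₚ h = ∀ x → Inverse.to f x ≈ Inverse.to h x

  record IsPermSubgroup (P : Perm → Set) : Set where
    field
      resp  : ∀ {f h} → f ≗ₚ h → P f → P h
      id∈   : P (Id.inverse X)
      comp∈ : ∀ {f h} → P f → P h → P (Comp.inverse h f)
      inv∈  : ∀ {f} → P f → P (Sym.inverse f)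

  record IsRegular (P : Perm → Set) : Set where
    field
      subgroup   : IsPermSubgroup P
      transitive : ∀ x y → Σ[ f ∈ Perm ] (P f × Inverse.to f x ≈ y)
      unique     : ∀ f h x → P f → P h →
                   Inverse.to f x ≈ Inverse.to h x → f ≗ₚ h

module _ (G : Group 0ℓ 0ℓ) where
  open Group G
  open GP G
  open SR setoid

  Pred : Set₁
  Pred = Carrier → Set

  IsFinite : Set
  IsFinite = Σ[ n ∈ ℕ ] Inverse setoid (≡.setoid (Fin n))

  record IsSubgroup (H : Pred) : Set where
    field
      resp : ∀ {x y} → x ≈ y → H x → H y
      ε∈   : H ε
      ∙∈   : ∀ {x y} → H x → H y → H (x ∙ y)
      ⁻¹∈  : ∀ {x} → H x → H (x ⁻¹)

  IsNormal : Pred → Set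
  IsNormal H = ∀ g x → H x → H (g ∙ x ∙ g ⁻¹)

  record IsNormalComplement (S T : Pred) : Set where
    field
      S-subgroup : IsSubgroup S
      S-normal   : IsNormal S
      S∙T≡G      : ∀ x → Σ[ s ∈ Carrier ] Σ[ t ∈ Carrier ] (S s × T t × x ≈ s ∙ t)
      S∩T≡e      : ∀ x → S x → T x → x ≈ ε

  -- left coset relation:  x H = y H  iff  x⁻¹ y ∈ H
  _∼[_]_ : Carrier → Pred → Carrier → Set
  x ∼[ H ] y = H (x ⁻¹ ∙ y)

  cosets : (H : Pred) → IsSubgroup H → Setoid 0ℓ 0ℓ
  cosets H Hs = record
    { Carrier = Carrier
    ; _≈_ = λ x y → x ∼[ H ] y
    ; isEquivalence = record
      { refl  = λ {x} → resp (sym (inverseˡ x)) ε∈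
      ; sym   = λ {x} {y} p → resp (lem-sym x y) (⁻¹∈ p)
      ; trans = λ {x} {y} {z} p q → resp (lem-trans x y z) (∙∈ p q)
      }
    }
    where
    open IsSubgroup Hs
    lem-sym : ∀ x y → (x ⁻¹ ∙ y) ⁻¹ ≈ y ⁻¹ ∙ x
    lem-sym x y = begin
      (x ⁻¹ ∙ y) ⁻¹      ≈⟨ ⁻¹-anti-homo-∙ (x ⁻¹) y ⟩
      y ⁻¹ ∙ x ⁻¹ ⁻¹     ≈⟨ ∙-congˡ (⁻¹-involutive x) ⟩
      y ⁻¹ ∙ x           ∎
    lem-trans : ∀ x y z → (x ⁻¹ ∙ y) ∙ (y ⁻¹ ∙ z) ≈ x ⁻¹ ∙ z
    lem-trans x y z = begin
      (x ⁻¹ ∙ y) ∙ (y ⁻¹ ∙ z)  ≈⟨ assoc (x ⁻¹) y (y ⁻¹ ∙ z) ⟩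
      x ⁻¹ ∙ (y ∙ (y ⁻¹ ∙ z))  ≈⟨ ∙-congˡ (sym (assoc y (y ⁻¹) z)) ⟩
      x ⁻¹ ∙ ((y ∙ y ⁻¹) ∙ z)  ≈⟨ ∙-congˡ (∙-congʳ (inverseʳ y)) ⟩
      x ⁻¹ ∙ (ε ∙ z)           ≈⟨ ∙-congˡ (identityˡ z) ⟩
      x ⁻¹ ∙ z                 ∎

  Elem : Pred → Set
  Elem H = Σ Carrier H

  subSetoid : Pred → Setoid 0ℓ 0ℓ
  subSetoid H = record
    { Carrier = Elem H
    ; _≈_ = λ u v → proj₁ u ≈ proj₁ v
    ; isEquivalence = record { refl = refl ; sym = sym ; trans = trans }
    }

  -- A ≤ Perm(G/H) is normalized by the left translations λ(G):
  -- for every h ∈ G and a ∈ A, λ(h) a λ(h)⁻¹ ∈ A, i.e. it agrees on G/H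
  -- with some a' ∈ A, where (λ(h) a λ(h)⁻¹)[xH] = h · a[h⁻¹ x H].
  NormalizedByλ : (H : Pred) (Hs : IsSubgroup H) → (Perm (cosets H Hs) → Set) → Set
  NormalizedByλ H Hs A = ∀ h a → A a →
    Σ[ a′ ∈ Perm (cosets H Hs) ] (A a′ ×
      (∀ x → Inverse.to a′ x ∼[ H ] (h ∙ Inverse.to a (h ⁻¹ ∙ x))))

  -- B ≤ Perm(H) is normalized by the left regular representation λ_H(H):
  -- (λ_H(u) b λ_H(u)⁻¹)[v] = u · b[u⁻¹ v].
  NormalizedByλ-sub : (H : Pred) → IsSubgroup H → (Perm (subSetoid H) → Set) → Set
  NormalizedByλ-sub H Hs B = ∀ (u : Elem H) b → B b →
    Σ[ b′ ∈ Perm (subSetoid H) ] (B b′ ×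
      (∀ (v : Elem H) → proj₁ (Inverse.to b′ v) ≈
          proj₁ u ∙ proj₁ (Inverse.to b (proj₁ u ⁻¹ ∙ proj₁ v ,
                                         IsSubgroup.∙∈ Hs (IsSubgroup.⁻¹∈ Hs (proj₂ u)) (proj₂ v)))))

  -- η(a,b) ∈ Perm(G) (as a function G → G) is characterised by
  --   η(a,b)[s t] = a[s] · b[t]   for s ∈ S, t ∈ H,
  -- where a[s] is the (unique) s' ∈ S with a[sH] = s'H.
  IsEta : (S H : Pred) (Hs : IsSubgroup H) →
          Perm (cosets H Hs) → Perm (subSetoid H) → Func setoid setoid → Set
  IsEta S H Hs a b σ = ∀ s t s′ → S s → (tH : H t) → S s′ →
    Inverse.to a s ∼[ H ] s′ →
    Func.to σ (s ∙ t) ≈ s′ ∙ proj₁ (Inverse.to b (t , tH))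

  InducedSet : (S H : Pred) (Hs : IsSubgroup H) →
               (Perm (cosets H Hs) → Set) → (Perm (subSetoid H) → Set) →
               Func setoid setoid → Set
  InducedSet S H Hs A B σ =
    Σ[ a ∈ Perm (cosets H Hs) ] (A a × Σ[ b ∈ Perm (subSetoid H) ] (B b × IsEta S H Hs a b σ))

  -- ρ(g) N ρ(g)⁻¹ where ρ(g)[x] = x g⁻¹, so (ρ(g) σ ρ(g)⁻¹)[x] = σ(x g) g⁻¹
  ρConj : Carrier → (Func setoid setoid → Set) → Func setoid setoid → Set
  ρConj g N τ = Σ[ σ ∈ Func setoid setoid ] (N σ ×
    (∀ x → Func.to τ x ≈ Func.to σ (x ∙ g) ∙ g ⁻¹))

  φ : Carrier → Carrier → Carrier
  φ g x = g ∙ x ∙ g ⁻¹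

  φImage : Carrier → Pred → Pred
  φImage g H x = Σ[ t ∈ Carrier ] (H t × x ≈ φ g t)

  φ-ε : ∀ c → φ c ε ≈ ε
  φ-ε c = begin
    c ∙ ε ∙ c ⁻¹  ≈⟨ ∙-congʳ (identityʳ c) ⟩
    c ∙ c ⁻¹      ≈⟨ inverseʳ c ⟩
    ε             ∎

  φ-∙ : ∀ c x y → φ c x ∙ φ c y ≈ φ c (x ∙ y)
  φ-∙ c x y = begin
    (c ∙ x ∙ c ⁻¹) ∙ (c ∙ y ∙ c ⁻¹)    ≈⟨ assoc (c ∙ x) (c ⁻¹) (c ∙ y ∙ c ⁻¹) ⟩
    (c ∙ x) ∙ (c ⁻¹ ∙ (c ∙ y ∙ c ⁻¹))  ≈⟨ ∙-congˡ (sym (assoc (c ⁻¹) (c ∙ y) (c ⁻¹))) ⟩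
    (c ∙ x) ∙ (c ⁻¹ ∙ (c ∙ y) ∙ c ⁻¹)  ≈⟨ ∙-congˡ (∙-congʳ (sym (assoc (c ⁻¹) c y))) ⟩
    (c ∙ x) ∙ ((c ⁻¹ ∙ c) ∙ y ∙ c ⁻¹)  ≈⟨ ∙-congˡ (∙-congʳ (∙-congʳ (inverseˡ c))) ⟩
    (c ∙ x) ∙ (ε ∙ y ∙ c ⁻¹)           ≈⟨ ∙-congˡ (∙-congʳ (identityˡ y)) ⟩
    (c ∙ x) ∙ (y ∙ c ⁻¹)               ≈⟨ sym (assoc (c ∙ x) y (c ⁻¹)) ⟩
    (c ∙ x) ∙ y ∙ c ⁻¹                 ≈⟨ ∙-congʳ (assoc c x y) ⟩
    c ∙ (x ∙ y) ∙ c ⁻¹                 ∎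

  φ-⁻¹ : ∀ c x → φ c (x ⁻¹) ≈ (φ c x) ⁻¹
  φ-⁻¹ c x = inverseʳ-unique (φ c x) (φ c (x ⁻¹)) (begin
    φ c x ∙ φ c (x ⁻¹)   ≈⟨ φ-∙ c x (x ⁻¹) ⟩
    φ c (x ∙ x ⁻¹)       ≈⟨ ∙-congʳ (∙-congˡ (inverseʳ x)) ⟩
    φ c ε                ≈⟨ φ-ε c ⟩
    ε                    ∎)

  φImage-subgroup : ∀ g {H} → IsSubgroup H → IsSubgroup (φImage g H)
  φImage-subgroup g {H} Hs = record
    { resp = λ { x≈y (t , tH , x≈) → t , tH , trans (sym x≈y) x≈ }
    ; ε∈   = ε , ε∈ , sym (φ-ε g)
    ; ∙∈   = λ { (t , tH , x≈) (u , uH , y≈) →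
               t ∙ u , ∙∈ tH uH , trans (∙-cong x≈ y≈) (φ-∙ g t u) }
    ; ⁻¹∈  = λ { (t , tH , x≈) → t ⁻¹ , ⁻¹∈ tH , trans (⁻¹-cong x≈) (sym (φ-⁻¹ g t)) }
    }
    where open IsSubgroup Hs

  φElem : ∀ g {H} → Elem H → Elem (φImage g H)
  φElem g (t , tH) = φ g t , t , tH , refl

  -- A' = φ̄ A φ̄⁻¹ ≤ Perm(G/T'), with φ̄(xT) = φ(x)T'.
  -- a' ∈ A' iff a' = φ̄ a φ̄⁻¹ for some a ∈ A, i.e. a' ∘ φ̄ = φ̄ ∘ a on G/T.
  ConjA : (g : Carrier) (H : Pred) (Hs : IsSubgroup H) →
          (Perm (cosets H Hs) → Set) →
          Perm (cosets (φImage g H) (φImage-subgroup g Hs)) → Set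
  ConjA g H Hs A a′ = Σ[ a ∈ Perm (cosets H Hs) ] (A a ×
    (∀ x → Inverse.to a′ (φ g x) ∼[ φImage g H ] φ g (Inverse.to a x)))

  -- B' = φ|_H B (φ|_H)⁻¹ ≤ Perm(φ(H)):  b' ∘ φ|_H = φ|_H ∘ b for some b ∈ B.
  ConjB : (g : Carrier) (H : Pred) →
          (Perm (subSetoid H) → Set) → Perm (subSetoid (φImage g H)) → Set
  ConjB g H B b′ = Σ[ b ∈ Perm (subSetoid H) ] (B b ×
    (∀ (u : Elem H) → proj₁ (Inverse.to b′ (φElem g u)) ≈ φ g (proj₁ (Inverse.to b u))))

{-# OPTIONS --safe #-}
-- Write g = s_g t_g with s_g ∈ S, t_g ∈ T.  Right multiplication by g sends s t′
-- (s ∈ S, t′ ∈ T′) to (s s_g)(s_g⁻¹ t′ g), again an S·T factorisation, so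
-- ρ(g)⁻¹ η′(a′,b′) ρ(g) = η(a,b) as soon as a′ = ρ(g) a ρ(g)⁻¹ on cosets and b′ is
-- b conjugated by κ : t ↦ s_g t g⁻¹ = φ_g(t_g⁻¹ t) from T to T′.  Because λ(G)
-- normalizes A, φ̄ A φ̄⁻¹ = φ̄ λ(g⁻¹) A λ(g) φ̄⁻¹ = ρ(g) A ρ(g)⁻¹, and likewise
-- B′ = κ B κ⁻¹ because λ_T(T) normalizes B.
module Submission where

open import Defs
open import Level using (0ℓ)
open import Algebra.Bundles using (Group)
open import Data.Product using (Σ-syntax; _×_; _,_; proj₁; proj₂)
open import Function.Bundles using (Func; _⇔_; Inverse; mk⇔)
open import Function.Definitions using (Congruent; StrictlyInverseˡ; StrictlyInverseʳ)
open import Relation.Binary.Bundles using (Setoid)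
import Function.Consequences.Setoid as FunctionProperties
import Function.Construct.Composition as Comp
import Function.Construct.Symmetry as Sym
import Algebra.Properties.Group as GroupProperties
import Relation.Binary.Reasoning.Setoid as SetoidReasoning

open Inverse using (to; from; to-cong; from-cong; strictlyInverseˡ; strictlyInverseʳ)

private
  variable
    X Y Z : Setoid 0ℓ 0ℓ

mkInverse : (f : Setoid.Carrier X → Setoid.Carrier Y) (f⁻¹ : Setoid.Carrier Y → Setoid.Carrier X) →
            Congruent (Setoid._≈_ X) (Setoid._≈_ Y) f → Congruent (Setoid._≈_ Y) (Setoid._≈_ X) f⁻¹ →
            StrictlyInverseˡ (Setoid._≈_ Y) f f⁻¹ → StrictlyInverseʳ (Setoid._≈_ X) f f⁻¹ →
            Inverse X Y
mkInverse {X} {Y} f f⁻¹ f-cong f⁻¹-cong invˡ invʳ = record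
  { to        = f
  ; from      = f⁻¹
  ; to-cong   = f-cong
  ; from-cong = f⁻¹-cong
  ; inverse   = FunctionProperties.strictlyInverseˡ⇒inverseˡ X Y f-cong invˡ
              , FunctionProperties.strictlyInverseʳ⇒inverseʳ X Y f⁻¹-cong invʳ
  }

record Intertwines (e : Inverse X Y) (f : Perm X) (h : Perm Y) : Set where
  constructor mkIntertwines
  field
    commute : ∀ x → Setoid._≈_ Y (to h (to e x)) (to e (to f x))

open Intertwines

conjugate : Inverse X Y → Perm X → Perm Y
conjugate e f = Comp.inverse (Comp.inverse (Sym.inverse e) f) e

conjugate-intertwines : (e : Inverse X Y) (f : Perm X) → Intertwines e f (conjugate e f)
conjugate-intertwines e f = mkIntertwines λ x → to-cong e (to-cong f (strictlyInverseʳ e x))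

intertwines-sym : ∀ {e : Inverse X Y} {f h} → Intertwines e f h → Intertwines (Sym.inverse e) h f
intertwines-sym {X} {e = e} {f} {h} e∘f≈h∘e = mkIntertwines λ y → begin
  to f (from e y)                  ≈⟨ strictlyInverseʳ e _ ⟨
  from e (to e (to f (from e y)))  ≈⟨ from-cong e (commute e∘f≈h∘e (from e y)) ⟨
  from e (to h (to e (from e y)))  ≈⟨ from-cong e (to-cong h (strictlyInverseˡ e y)) ⟩
  from e (to h y)                  ∎
  where open SetoidReasoning X

intertwines-resp : ∀ {e e′ : Inverse X Y} {f h} → (∀ x → Setoid._≈_ Y (to e x) (to e′ x)) →
                   Intertwines e f h → Intertwines e′ f h
intertwines-resp {Y = Y} {e} {e′} {f} {h} e≈e′ e∘f≈h∘e = mkIntertwines λ x → begin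
  to h (to e′ x)  ≈⟨ to-cong h (e≈e′ x) ⟨
  to h (to e x)   ≈⟨ commute e∘f≈h∘e x ⟩
  to e (to f x)   ≈⟨ e≈e′ (to f x) ⟩
  to e′ (to f x)  ∎
  where open SetoidReasoning Y

intertwines-∘ : ∀ {e : Inverse X Y} {e′ : Inverse Y Z} {f h k} →
                Intertwines e f h → Intertwines e′ h k → Intertwines (Comp.inverse e e′) f k
intertwines-∘ {Z = Z} {e} {e′} e∘f≈h∘e e′∘h≈k∘e′ = mkIntertwines λ x →
  Setoid.trans Z (commute e′∘h≈k∘e′ (to e x)) (to-cong e′ (commute e∘f≈h∘e x))

module _ (G : Group 0ℓ 0ℓ) where
  open Group G
  open GroupProperties G
  open SetoidReasoning setoid

  ∙-split : ∀ c x y → x ∙ y ≈ (x ∙ c) ∙ (c ⁻¹ ∙ y)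
  ∙-split c x y = trans (∙-congˡ (sym (\\-leftDividesˡ c y))) (sym (assoc x c (c ⁻¹ ∙ y)))

  ∙-split⁻¹ : ∀ c x y → x ∙ y ≈ (x ∙ c ⁻¹) ∙ (c ∙ y)
  ∙-split⁻¹ c x y = trans (∙-congˡ (sym (\\-leftDividesʳ c y))) (sym (assoc x (c ⁻¹) (c ∙ y)))

  ∙ʳ-quotient : ∀ c x y → (x ∙ c) ⁻¹ ∙ (y ∙ c) ≈ c ⁻¹ ∙ (x ⁻¹ ∙ y) ∙ c
  ∙ʳ-quotient c x y = begin
    (x ∙ c) ⁻¹ ∙ (y ∙ c)      ≈⟨ ∙-congʳ (⁻¹-anti-homo-∙ x c) ⟩
    c ⁻¹ ∙ x ⁻¹ ∙ (y ∙ c)     ≈⟨ assoc (c ⁻¹) (x ⁻¹) (y ∙ c) ⟩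
    c ⁻¹ ∙ (x ⁻¹ ∙ (y ∙ c))   ≈⟨ ∙-congˡ (assoc (x ⁻¹) y c) ⟨
    c ⁻¹ ∙ (x ⁻¹ ∙ y ∙ c)     ≈⟨ assoc (c ⁻¹) (x ⁻¹ ∙ y) c ⟨
    c ⁻¹ ∙ (x ⁻¹ ∙ y) ∙ c     ∎

  φ-cong : ∀ c {x y} → x ≈ y → φ G c x ≈ φ G c y
  φ-cong c x≈y = ∙-congʳ (∙-congˡ x≈y)

  φ-\\ : ∀ c x → φ G c (c ⁻¹ ∙ x) ≈ x ∙ c ⁻¹
  φ-\\ c x = ∙-congʳ (\\-leftDividesˡ c x)

  φ-cancel : ∀ c x → c ⁻¹ ∙ φ G c x ∙ c ≈ x
  φ-cancel c x = begin
    c ⁻¹ ∙ (c ∙ x ∙ c ⁻¹) ∙ c  ≈⟨ ∙-congʳ (assoc (c ⁻¹) (c ∙ x) (c ⁻¹)) ⟨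
    c ⁻¹ ∙ (c ∙ x) ∙ c ⁻¹ ∙ c  ≈⟨ //-rightDividesˡ c (c ⁻¹ ∙ (c ∙ x)) ⟩
    c ⁻¹ ∙ (c ∙ x)             ≈⟨ \\-leftDividesʳ c x ⟩
    x                          ∎

  φ⁻¹-φ : ∀ c x → φ G (c ⁻¹) (φ G c x) ≈ x
  φ⁻¹-φ c x = trans (∙-congˡ (⁻¹-involutive c)) (φ-cancel c x)

  φ-φ⁻¹ : ∀ c x → φ G c (φ G (c ⁻¹) x) ≈ x
  φ-φ⁻¹ c x = trans (∙-congʳ (∙-congʳ (sym (⁻¹-involutive c)))) (φ-cancel (c ⁻¹) x)

  ρ-unconjugate : Carrier → Func setoid setoid → Func setoid setoid
  ρ-unconjugate g τ = record
    { to   = λ x → Func.to τ (x ∙ g ⁻¹) ∙ g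
    ; cong = λ x≈y → ∙-congʳ (Func.cong τ (∙-congʳ x≈y))
    }

  ρ-unconjugate-spec : ∀ g τ x → Func.to τ x ≈ Func.to (ρ-unconjugate g τ) (x ∙ g) ∙ g ⁻¹
  ρ-unconjugate-spec g τ x = sym (trans (//-rightDividesʳ g _) (Func.cong τ (//-rightDividesʳ g x)))

  module _ {H : Pred G} (Hsub : IsSubgroup G H) where
    open IsSubgroup Hsub

    ≈⇒∼ : ∀ {x y} → x ≈ y → H (x ⁻¹ ∙ y)
    ≈⇒∼ {x} x≈y = resp (trans (sym (inverseˡ x)) (∙-congˡ x≈y)) ε∈

    ∼-∙ˡ : ∀ h {x y} → H (x ⁻¹ ∙ y) → H ((h ∙ x) ⁻¹ ∙ (h ∙ y))
    ∼-∙ˡ h {x} {y} x∼y = resp (sym (begin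
      (h ∙ x) ⁻¹ ∙ (h ∙ y)     ≈⟨ ∙-congʳ (⁻¹-anti-homo-∙ h x) ⟩
      x ⁻¹ ∙ h ⁻¹ ∙ (h ∙ y)    ≈⟨ assoc (x ⁻¹) (h ⁻¹) (h ∙ y) ⟩
      x ⁻¹ ∙ (h ⁻¹ ∙ (h ∙ y))  ≈⟨ ∙-congˡ (\\-leftDividesʳ h y) ⟩
      x ⁻¹ ∙ y                 ∎)) x∼y

  module _ {H : Pred G} (Hsub : IsSubgroup G H) where
    open IsSubgroup Hsub

    leftTranslation : Carrier → Perm (cosets G H Hsub)
    leftTranslation h = mkInverse (h ∙_) (h ⁻¹ ∙_) (∼-∙ˡ Hsub h) (∼-∙ˡ Hsub (h ⁻¹))
      (λ x → ≈⇒∼ Hsub (\\-leftDividesˡ h x)) (λ x → ≈⇒∼ Hsub (\\-leftDividesʳ h x))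

    leftTranslation-sub : Elem G H → Perm (subSetoid G H)
    leftTranslation-sub (h , hH) = mkInverse
      (λ (x , xH) → h ∙ x , ∙∈ hH xH) (λ (x , xH) → h ⁻¹ ∙ x , ∙∈ (⁻¹∈ hH) xH)
      ∙-congˡ ∙-congˡ
      (λ (x , _) → \\-leftDividesˡ h x) (λ (x , _) → \\-leftDividesʳ h x)

    -- ρ(c) : xH ↦ x c⁻¹ φ_c(H); well defined because x H c⁻¹ = x c⁻¹ (c H c⁻¹).
    rightTranslation : ∀ c → Inverse (cosets G H Hsub) (cosets G (φImage G c H) (φImage-subgroup G c Hsub))
    rightTranslation c = mkInverse (_∙ c ⁻¹) (_∙ c) ρ-cong ρ⁻¹-cong
      (λ y → ≈⇒∼ (φImage-subgroup G c Hsub) (//-rightDividesʳ c y))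
      (λ x → ≈⇒∼ Hsub (//-rightDividesˡ c x))
      where
      ρ-cong : ∀ {x y} → H (x ⁻¹ ∙ y) → φImage G c H ((x ∙ c ⁻¹) ⁻¹ ∙ (y ∙ c ⁻¹))
      ρ-cong {x} {y} x∼y = x ⁻¹ ∙ y , x∼y ,
        trans (∙ʳ-quotient (c ⁻¹) x y) (∙-congʳ (∙-congʳ (⁻¹-involutive c)))
      ρ⁻¹-cong : ∀ {x y} → φImage G c H (x ⁻¹ ∙ y) → H ((x ∙ c) ⁻¹ ∙ (y ∙ c))
      ρ⁻¹-cong {x} {y} (t , tH , x∼y) =
        resp (sym (trans (∙ʳ-quotient c x y) (trans (∙-congʳ (∙-congˡ x∼y)) (φ-cancel c t)))) tH

    conjugation : ∀ c → Inverse (cosets G H Hsub) (cosets G (φImage G c H) (φImage-subgroup G c Hsub))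
    conjugation c = mkInverse (φ G c) (φ G (c ⁻¹)) conj-cong conj⁻¹-cong
      (λ y → ≈⇒∼ (φImage-subgroup G c Hsub) (φ-φ⁻¹ c y)) (λ x → ≈⇒∼ Hsub (φ⁻¹-φ c x))
      where
      conj-cong : ∀ {x y} → H (x ⁻¹ ∙ y) → φImage G c H (φ G c x ⁻¹ ∙ φ G c y)
      conj-cong {x} {y} x∼y = x ⁻¹ ∙ y , x∼y ,
        trans (∙-congʳ (sym (φ-⁻¹ G c x))) (φ-∙ G c (x ⁻¹) y)
      conj⁻¹-cong : ∀ {x y} → φImage G c H (x ⁻¹ ∙ y) → H (φ G (c ⁻¹) x ⁻¹ ∙ φ G (c ⁻¹) y)
      conj⁻¹-cong {x} {y} (t , tH , x∼y) = resp
        (sym (trans (∙-congʳ (sym (φ-⁻¹ G (c ⁻¹) x)))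
             (trans (φ-∙ G (c ⁻¹) (x ⁻¹) y) (trans (φ-cong (c ⁻¹) x∼y) (φ⁻¹-φ c t)))))
        tH

    conjugation-sub : ∀ c → Inverse (subSetoid G H) (subSetoid G (φImage G c H))
    conjugation-sub c = mkInverse (φElem G c) conj⁻¹ (φ-cong c) (φ-cong (c ⁻¹))
      (λ (y , _) → φ-φ⁻¹ c y) (λ (x , _) → φ⁻¹-φ c x)
      where
      conj⁻¹ : Elem G (φImage G c H) → Elem G H
      conj⁻¹ (y , t , tH , y≈φt) =
        φ G (c ⁻¹) y , resp (sym (trans (φ-cong (c ⁻¹) y≈φt) (φ⁻¹-φ c t))) tH

    normalizedByλ-intertwines : ∀ {A} → NormalizedByλ G H Hsub A →
      ∀ h {a} → A a → Σ[ a′ ∈ Perm (cosets G H Hsub) ] (A a′ × Intertwines (leftTranslation h) a a′)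
    normalizedByλ-intertwines nA h {a} aA with nA h a aA
    ... | a′ , a′A , a′≈λaλ⁻¹ = a′ , a′A , mkIntertwines λ x →
      Setoid.trans (cosets G H Hsub) (a′≈λaλ⁻¹ (h ∙ x))
        (∼-∙ˡ Hsub h (to-cong a (≈⇒∼ Hsub (\\-leftDividesʳ h x))))

    normalizedByλ-sub-intertwines : ∀ {B} → NormalizedByλ-sub G H Hsub B →
      ∀ u {b} → B b → Σ[ b′ ∈ Perm (subSetoid G H) ] (B b′ × Intertwines (leftTranslation-sub u) b b′)
    normalizedByλ-sub-intertwines nB u@(h , _) {b} bB with nB u b bB
    ... | b′ , b′B , b′≈λbλ⁻¹ = b′ , b′B , mkIntertwines λ (x , _) →
      trans (b′≈λbλ⁻¹ _) (∙-congˡ (to-cong b (\\-leftDividesʳ h x)))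

module _ (G : Group 0ℓ 0ℓ) {T : Pred G} (Tsub : IsSubgroup G T) (g : Group.Carrier G) where
  open Group G

  private
    φ̄ = conjugation G Tsub g
    ρ = rightTranslation G Tsub g

  -- ρ(g) = φ̄ λ(g⁻¹); this is why conjugating A by φ̄ amounts to conjugating it by ρ(g).
  φ̄∘λ≈ρ : ∀ x → φImage G g T (φ G g (g ⁻¹ ∙ x) ⁻¹ ∙ to ρ x)
  φ̄∘λ≈ρ x = ≈⇒∼ G (φImage-subgroup G g Tsub) (φ-\\ G g x)

  ConjA-of-A : ∀ {A} → NormalizedByλ G T Tsub A → ∀ {a} → A a →
    Σ[ a′ ∈ Perm (cosets G (φImage G g T) (φImage-subgroup G g Tsub)) ]
      (ConjA G g T Tsub A a′ × Intertwines ρ a a′)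
  ConjA-of-A nA aA with normalizedByλ-intertwines G Tsub nA (g ⁻¹) aA
  ... | a₁ , a₁A , λa≈a₁λ = conjugate φ̄ a₁ , (a₁ , a₁A , commute (conjugate-intertwines φ̄ a₁)) ,
    intertwines-resp φ̄∘λ≈ρ (intertwines-∘ λa≈a₁λ (conjugate-intertwines φ̄ a₁))

  A-of-ConjA : ∀ {A} → NormalizedByλ G T Tsub A → ∀ {a′} → ConjA G g T Tsub A a′ →
    Σ[ a ∈ Perm (cosets G T Tsub) ] (A a × Intertwines ρ a a′)
  A-of-ConjA nA (a₁ , a₁A , φ̄a₁≈a′φ̄) with normalizedByλ-intertwines G Tsub nA g a₁A
  ... | a , aA , λa₁≈aλ = a , aA ,
    intertwines-resp φ̄∘λ≈ρ
      (intertwines-∘ (intertwines-sym λa₁≈aλ) (mkIntertwines {e = φ̄} φ̄a₁≈a′φ̄))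

  -- t ↦ φ_g(t_g⁻¹ t), which is t ↦ s_g t g⁻¹ when g = s_g t_g.
  ρ-sub : ∀ {tg} → T tg → Inverse (subSetoid G T) (subSetoid G (φImage G g T))
  ρ-sub tgT = Comp.inverse (Sym.inverse (leftTranslation-sub G Tsub (_ , tgT))) (conjugation-sub G Tsub g)

  module _ {tg} (tgT : T tg) where
    private
      φ|T = conjugation-sub G Tsub g

    ConjB-of-B : ∀ {B} → NormalizedByλ-sub G T Tsub B → ∀ {b} → B b →
      Σ[ b′ ∈ Perm (subSetoid G (φImage G g T)) ] (ConjB G g T B b′ × Intertwines (ρ-sub tgT) b b′)
    ConjB-of-B nB bB with normalizedByλ-sub-intertwines G Tsub nB (tg ⁻¹ , IsSubgroup.⁻¹∈ Tsub tgT) bB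
    ... | b₁ , b₁B , λb≈b₁λ = conjugate φ|T b₁ , (b₁ , b₁B , commute (conjugate-intertwines φ|T b₁)) ,
      intertwines-resp (λ _ → refl) (intertwines-∘ λb≈b₁λ (conjugate-intertwines φ|T b₁))

    B-of-ConjB : ∀ {B} → NormalizedByλ-sub G T Tsub B → ∀ {b′} → ConjB G g T B b′ →
      Σ[ b ∈ Perm (subSetoid G T) ] (B b × Intertwines (ρ-sub tgT) b b′)
    B-of-ConjB nB (b₁ , b₁B , φb₁≈b′φ) with normalizedByλ-sub-intertwines G Tsub nB (tg , tgT) b₁B
    ... | b , bB , λb₁≈bλ = b , bB ,
      intertwines-∘ (intertwines-sym λb₁≈bλ) (mkIntertwines {e = φ|T} φb₁≈b′φ)

module _ (G : Group 0ℓ 0ℓ) {S T : Pred G} (Ssub : IsSubgroup G S) (Tsub : IsSubgroup G T)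
         {g sg tg : Group.Carrier G} (sgS : S sg) (tgT : T tg)
         (g≈sgtg : Group._≈_ G g (Group._∙_ G sg tg)) where
  open Group G
  open GroupProperties G
  open SetoidReasoning setoid
  open IsSubgroup Ssub using () renaming (∙∈ to ∙∈S; ⁻¹∈ to ⁻¹∈S)

  private
    T′ = φImage G g T
    T′sub = φImage-subgroup G g Tsub
    ρ = rightTranslation G Tsub g
    κ = ρ-sub G Tsub g tgT
    module G/T = Setoid (cosets G T Tsub)
    module G/T′ = Setoid (cosets G T′ T′sub)

    sg⁻¹∙g≈tg : sg ⁻¹ ∙ g ≈ tg
    sg⁻¹∙g≈tg = trans (∙-congˡ g≈sgtg) (\\-leftDividesʳ sg tg)

    g∙tg⁻¹≈sg : g ∙ tg ⁻¹ ≈ sg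
    g∙tg⁻¹≈sg = trans (∙-congʳ g≈sgtg) (//-rightDividesʳ tg sg)

    tg∙g⁻¹≈sg⁻¹ : tg ∙ g ⁻¹ ≈ sg ⁻¹
    tg∙g⁻¹≈sg⁻¹ = trans (∙-congˡ (trans (⁻¹-cong g≈sgtg) (⁻¹-anti-homo-∙ sg tg)))
                        (\\-leftDividesˡ tg (sg ⁻¹))

  ρ-sub-to : ∀ t → proj₁ (to κ t) ≈ sg ∙ (proj₁ t ∙ g ⁻¹)
  ρ-sub-to (t , _) = begin
    g ∙ (tg ⁻¹ ∙ t) ∙ g ⁻¹  ≈⟨ ∙-congʳ (assoc g (tg ⁻¹) t) ⟨
    g ∙ tg ⁻¹ ∙ t ∙ g ⁻¹    ≈⟨ ∙-congʳ (∙-congʳ g∙tg⁻¹≈sg) ⟩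
    sg ∙ t ∙ g ⁻¹           ≈⟨ assoc sg t (g ⁻¹) ⟩
    sg ∙ (t ∙ g ⁻¹)         ∎

  ρ-sub-from : ∀ t′ → proj₁ (from κ t′) ≈ sg ⁻¹ ∙ (proj₁ t′ ∙ g)
  ρ-sub-from (t′ , _) = begin
    tg ∙ (g ⁻¹ ∙ t′ ∙ g ⁻¹ ⁻¹)
      ≈⟨ ∙-cong (sym sg⁻¹∙g≈tg) (trans (∙-congˡ (⁻¹-involutive g)) (assoc (g ⁻¹) t′ g)) ⟩
    sg ⁻¹ ∙ g ∙ (g ⁻¹ ∙ (t′ ∙ g))   ≈⟨ assoc (sg ⁻¹) g (g ⁻¹ ∙ (t′ ∙ g)) ⟩
    sg ⁻¹ ∙ (g ∙ (g ⁻¹ ∙ (t′ ∙ g))) ≈⟨ ∙-congˡ (\\-leftDividesˡ g (t′ ∙ g)) ⟩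
    sg ⁻¹ ∙ (t′ ∙ g)                ∎

  ∙sg∼∙g : ∀ x → (x ∙ sg) G/T.≈ (x ∙ g)
  ∙sg∼∙g x = ∼-∙ˡ G Tsub x (IsSubgroup.resp Tsub (sym sg⁻¹∙g≈tg) tgT)

  ∙g⁻¹∼∙sg⁻¹ : ∀ x → (x ∙ g ⁻¹) G/T′.≈ (x ∙ sg ⁻¹)
  ∙g⁻¹∼∙sg⁻¹ x = ∼-∙ˡ G T′sub x (tg , tgT , (begin
    g ⁻¹ ⁻¹ ∙ sg ⁻¹     ≈⟨ ∙-cong (⁻¹-involutive g) (sym tg∙g⁻¹≈sg⁻¹) ⟩
    g ∙ (tg ∙ g ⁻¹)     ≈⟨ assoc g tg (g ⁻¹) ⟨
    g ∙ tg ∙ g ⁻¹       ∎))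

  module _ {σ τ : Func setoid setoid} (τ≈ρσρ⁻¹ : ∀ x → Func.to τ x ≈ Func.to σ (x ∙ g) ∙ g ⁻¹)
           {a a′ b b′} (ρa≈a′ρ : Intertwines ρ a a′) (κb≈b′κ : Intertwines κ b b′) where

    isEta-ρConj : IsEta G S T Tsub a b σ → IsEta G S T′ T′sub a′ b′ τ
    isEta-ρConj ηab s t′ s″ sS t′T′ s″S a′s∼s″ = begin
      Func.to τ (s ∙ t′)                     ≈⟨ τ≈ρσρ⁻¹ (s ∙ t′) ⟩
      Func.to σ (s ∙ t′ ∙ g) ∙ g ⁻¹          ≈⟨ ∙-congʳ (Func.cong σ split) ⟩
      Func.to σ ((s ∙ sg) ∙ proj₁ u) ∙ g ⁻¹
        ≈⟨ ∙-congʳ (ηab (s ∙ sg) (proj₁ u) (s″ ∙ sg) (∙∈S sS sgS) (proj₂ u) (∙∈S s″S sgS) a-step) ⟩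
      (s″ ∙ sg) ∙ proj₁ (to b u) ∙ g ⁻¹      ≈⟨ ∙-congʳ (∙-congˡ b-step) ⟩
      (s″ ∙ sg) ∙ (sg ⁻¹ ∙ (y ∙ g)) ∙ g ⁻¹   ≈⟨ ∙-congʳ (∙-split G sg s″ (y ∙ g)) ⟨
      s″ ∙ (y ∙ g) ∙ g ⁻¹                    ≈⟨ ∙-congʳ (assoc s″ y g) ⟨
      s″ ∙ y ∙ g ∙ g ⁻¹                      ≈⟨ //-rightDividesʳ g (s″ ∙ y) ⟩
      s″ ∙ y                                 ∎
      where
      t″ : Elem G T′
      t″ = t′ , t′T′
      u = from κ t″
      y = proj₁ (to b′ t″)
      split : s ∙ t′ ∙ g ≈ (s ∙ sg) ∙ proj₁ u
      split = trans (assoc s t′ g) (trans (∙-split G sg s (t′ ∙ g)) (∙-congˡ (sym (ρ-sub-from t″))))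
      b-step : proj₁ (to b u) ≈ sg ⁻¹ ∙ (y ∙ g)
      b-step = trans (commute (intertwines-sym κb≈b′κ) t″) (ρ-sub-from (to b′ t″))
      a-step : to a (s ∙ sg) G/T.≈ s″ ∙ sg
      a-step = G/T.trans (to-cong a (∙sg∼∙g s))
        (G/T.trans (commute (intertwines-sym ρa≈a′ρ) s)
        (G/T.trans (from-cong ρ a′s∼s″) (G/T.sym (∙sg∼∙g s″))))

    isEta-ρConj⁻¹ : IsEta G S T′ T′sub a′ b′ τ → IsEta G S T Tsub a b σ
    isEta-ρConj⁻¹ ηa′b′ s t s′ sS tT s′S as∼s′ = begin
      Func.to σ (s ∙ t)                      ≈⟨ σ≈ρ⁻¹τρ (s ∙ t) ⟩
      Func.to τ (s ∙ t ∙ g ⁻¹) ∙ g           ≈⟨ ∙-congʳ (Func.cong τ split) ⟩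
      Func.to τ ((s ∙ sg ⁻¹) ∙ proj₁ u) ∙ g
        ≈⟨ ∙-congʳ (ηa′b′ (s ∙ sg ⁻¹) (proj₁ u) (s′ ∙ sg ⁻¹)
                          (∙∈S sS (⁻¹∈S sgS)) (proj₂ u) (∙∈S s′S (⁻¹∈S sgS)) a′-step) ⟩
      (s′ ∙ sg ⁻¹) ∙ proj₁ (to b′ u) ∙ g     ≈⟨ ∙-congʳ (∙-congˡ b′-step) ⟩
      (s′ ∙ sg ⁻¹) ∙ (sg ∙ (y ∙ g ⁻¹)) ∙ g   ≈⟨ ∙-congʳ (∙-split⁻¹ G sg s′ (y ∙ g ⁻¹)) ⟨
      s′ ∙ (y ∙ g ⁻¹) ∙ g                    ≈⟨ ∙-congʳ (assoc s′ y (g ⁻¹)) ⟨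
      s′ ∙ y ∙ g ⁻¹ ∙ g                      ≈⟨ //-rightDividesˡ g (s′ ∙ y) ⟩
      s′ ∙ y                                 ∎
      where
      u = to κ (t , tT)
      y = proj₁ (to b (t , tT))
      σ≈ρ⁻¹τρ : ∀ x → Func.to σ x ≈ Func.to τ (x ∙ g ⁻¹) ∙ g
      σ≈ρ⁻¹τρ x = sym (trans (∙-congʳ (τ≈ρσρ⁻¹ (x ∙ g ⁻¹)))
                      (trans (//-rightDividesˡ g _) (Func.cong σ (//-rightDividesˡ g x))))
      split : s ∙ t ∙ g ⁻¹ ≈ (s ∙ sg ⁻¹) ∙ proj₁ u
      split = trans (assoc s t (g ⁻¹))
                (trans (∙-split⁻¹ G sg s (t ∙ g ⁻¹)) (∙-congˡ (sym (ρ-sub-to (t , tT)))))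
      b′-step : proj₁ (to b′ u) ≈ sg ∙ (y ∙ g ⁻¹)
      b′-step = trans (commute κb≈b′κ (t , tT)) (ρ-sub-to (to b (t , tT)))
      a′-step : to a′ (s ∙ sg ⁻¹) G/T′.≈ s′ ∙ sg ⁻¹
      a′-step = G/T′.trans (to-cong a′ (G/T′.sym (∙g⁻¹∼∙sg⁻¹ s)))
        (G/T′.trans (commute ρa≈a′ρ s)
        (G/T′.trans (to-cong ρ as∼s′) (∙g⁻¹∼∙sg⁻¹ s′)))

  ρConj⇔InducedSet : ∀ {A B} → NormalizedByλ G T Tsub A → NormalizedByλ-sub G T Tsub B →
    ∀ τ → ρConj G g (InducedSet G S T Tsub A B) τ
            ⇔ InducedSet G S T′ T′sub (ConjA G g T Tsub A) (ConjB G g T B) τ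
  ρConj⇔InducedSet {A} {B} nA nB τ = mk⇔ forward backward
    where
    forward : ρConj G g (InducedSet G S T Tsub A B) τ →
              InducedSet G S T′ T′sub (ConjA G g T Tsub A) (ConjB G g T B) τ
    forward (σ , (a , aA , b , bB , ηab) , τ≈ρσρ⁻¹)
      with ConjA-of-A G Tsub g {A} nA aA | ConjB-of-B G Tsub g tgT {B} nB bB
    ... | a′ , a′∈A′ , ρa≈a′ρ | b′ , b′∈B′ , κb≈b′κ =
      a′ , a′∈A′ , b′ , b′∈B′ , isEta-ρConj {σ} {τ} τ≈ρσρ⁻¹ ρa≈a′ρ κb≈b′κ ηab

    backward : InducedSet G S T′ T′sub (ConjA G g T Tsub A) (ConjB G g T B) τ →
               ρConj G g (InducedSet G S T Tsub A B) τ
    backward (a′ , a′∈A′ , b′ , b′∈B′ , ηa′b′)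
      with A-of-ConjA G Tsub g {A} nA {a′} a′∈A′ | B-of-ConjB G Tsub g tgT {B} nB {b′} b′∈B′
    ... | a , aA , ρa≈a′ρ | b , bB , κb≈b′κ =
      σ , (a , aA , b , bB , isEta-ρConj⁻¹ {σ} {τ} τ≈ρσρ⁻¹ ρa≈a′ρ κb≈b′κ ηa′b′) ,
      τ≈ρσρ⁻¹
      where
      σ = ρ-unconjugate G g τ
      τ≈ρσρ⁻¹ = ρ-unconjugate-spec G g τ

proposition6p7 : (G : Group 0ℓ 0ℓ) → IsFinite G →
    (S T : Pred G) → (Tsub : IsSubgroup G T) → IsNormalComplement G S T →
    (A : Perm (cosets G T Tsub) → Set) → IsRegular (cosets G T Tsub) A →
    NormalizedByλ G T Tsub A →
    (B : Perm (subSetoid G T) → Set) → IsRegular (subSetoid G T) B →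
    NormalizedByλ-sub G T Tsub B →
    (g : Group.Carrier G) →
    (τ : Func (Group.setoid G) (Group.setoid G)) →
    ρConj G g (InducedSet G S T Tsub A B) τ
    ⇔ InducedSet G S (φImage G g T) (φImage-subgroup G g Tsub)
    (ConjA G g T Tsub A) (ConjB G g T B) τ
proposition6p7 G _ S T Tsub nc A _ nA B _ nB g τ
  with (sg , tg , sgS , tgT , g≈sgtg) ← IsNormalComplement.S∙T≡G nc g =
  ρConj⇔InducedSet G (IsNormalComplement.S-subgroup nc) Tsub sgS tgT g≈sgtg nA nB τ
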